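{- Let $d\ge 1$, $0\le m\le d$, let $n\ge 2$ be an integer with factorization $n=\prod_{i=1}^{k} p_i^{e_i}$ into powers of distinct primes $p_i$, and let $a$ be an integer with $\gcd(a,n)=1$. Then $$\#\bar{S}_d(m;a;n)=\prod_{i=1}^k \#\bar{S}_d(m;a;p_i^{e_i}).$$
   Context: For an integer $n\ge 2$ and an integer $a$ coprime to $n$, the $d$-dimensional modular hyperbola is $H_d(a;n)=\{(x_1,\dots,x_d)\in\mathbb{Z}^d: x_1\cdots x_d\equiv a \bmod n,\ 1\le x_1,\dots,x_d<n\}$. For $0\le m\le d$, the generalized signed sumset is $\bar{S}_d(m;a;n)=\{x_1+\cdots+x_m-x_{m+1}-\cdots-x_d \bmod n : (x_1,\dots,x_d)\in H_d(a;n)\}$, a subset of $\mathbb{Z}/n\mathbb{Z}$ ($m$ is the number of plus signs). -}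

module Defs where

open import Data.Nat as ℕ using (ℕ; zero; suc; _<_; _<ᵇ_)
open import Data.Integer as ℤ using (ℤ; +_)
open import Data.Integer.DivMod using (_%ℕ_)
open import Data.List as List using (List; []; _∷_; map; filter; concatMap; length; deduplicate; upTo; drop)
open import Data.Vec using (Vec; []; _∷_)
open import Data.Bool using (if_then_else_)
open import Relation.Binary.PropositionalEquality using (_≡_)

tuples : (n d : ℕ) → List (Vec ℕ d)
tuples n zero    = [] ∷ []
tuples n (suc d) = concatMap (λ x → map (x ∷_) (tuples n d)) (drop 1 (upTo n))

prodℤ : ∀ {d} → Vec ℕ d → ℤ
prodℤ []       = + 1
prodℤ (x ∷ xs) = + x ℤ.* prodℤ xs

signedSum : (m : ℕ) → ∀ {d} → Vec ℕ d → ℤ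
signedSum m       []       = + 0
signedSum zero    (x ∷ xs) = ℤ.- (+ x) ℤ.+ signedSum zero xs
signedSum (suc m) (x ∷ xs) = + x ℤ.+ signedSum m xs

-- The generalized signed sumset S̄_d(m;a;n) ⊆ ℤ/nℤ, with residues represented
-- by their least non-negative representatives in {0,…,n-1}, listed without repetition.
-- (Only meaningful for n ≥ 1; for n = 0 it is defined to be empty.)
signedSumset : (d m : ℕ) (a : ℤ) (n : ℕ) → List ℕ
signedSumset d m a zero    = []
signedSumset d m a (suc k) =
  deduplicate ℕ._≟_
    (map (λ x → signedSum m x %ℕ suc k)
      (filter (λ x → prodℤ x %ℕ suc k ℕ.≟ a %ℕ suc k) (tuples (suc k) d)))

#S̄ : (d m : ℕ) (a : ℤ) (n : ℕ) → ℕ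
#S̄ d m a n = length (signedSumset d m a n)

{-# OPTIONS --safe #-}

-- If gcd(M, K) = 1, the map r ↦ (r mod M, r mod K) is injective on residues modulo MK, and it
-- sends S̄_d(m;a;MK) onto S̄_d(m;a;M) × S̄_d(m;a;K). Reducing a point of H_d(a;MK) coordinatewise
-- modulo M gives a point of H_d(a;M), where no coordinate becomes 0 because a is a unit; conversely,
-- lifting two points of H_d(a;M) and H_d(a;K) coordinatewise by the Chinese remainder theorem gives
-- a point of H_d(a;MK). So #S̄_d(m;a;-) is multiplicative on coprime moduli, and the prime powers
-- of a factorisation are pairwise coprime.

module Submission where

open import Defs
open import Data.Nat as ℕ using (ℕ; zero; suc; _≤_; _<_; _^_; s≤s; z≤n; NonZero)
import Data.Nat.Properties as ℕP
import Data.Nat.Divisibility as ℕD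
open import Data.Nat.DivMod using (_%_; m%n<n; m<n⇒m%n≡m)
open import Data.Nat.Coprimality as Coprimality using (Coprime)
open import Data.Nat.GCD using (module Bézout)
open import Data.Nat.Primality using (Prime; prime⇒irreducible; prime⇒nonTrivial)
open import Data.Nat.ListAction using (product)
import Data.Nat.ListAction.Properties as ListActionP
open import Data.Integer as ℤ using (ℤ; +_; _+_; _*_; _-_; -_; ∣_∣; 0ℤ; 1ℤ)
import Data.Integer.Properties as ℤP
open import Data.Integer.DivMod using (_%ℕ_; _/ℕ_; n%ℕd<d; a≡a%ℕn+[a/ℕn]*n)
open import Data.Integer.Divisibility.Signed as ℤD using (divides; ∣ᵤ⇒∣; ∣⇒∣ᵤ)
open import Data.Integer.GCD using (gcd)
open import Data.Integer.Tactic.RingSolver using (solve-∀)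
open import Data.List as List using (List; []; _∷_; map; filter; length; cartesianProduct)
import Data.List.Properties as ListP
open import Data.List.Membership.Propositional using (_∈_; find; lose)
open import Data.List.Membership.Propositional.Properties
open import Data.List.Membership.Propositional.Properties.WithK using (unique∧set⇒bag)
open import Data.List.Relation.Binary.BagAndSetEquality using (∼bag⇒↭)
open import Data.List.Relation.Binary.Permutation.Propositional.Properties using (↭-length)
open import Data.List.Relation.Unary.Any using (here; there)
open import Data.List.Relation.Unary.All as All using (All; []; _∷_)
import Data.List.Relation.Unary.All.Properties as AllP
open import Data.List.Relation.Unary.AllPairs using (AllPairs; []; _∷_)
open import Data.List.Relation.Unary.Unique.Propositional using (Unique)
import Data.List.Relation.Unary.Unique.Propositional.Properties as UniqueP
open import Data.List.Relation.Unary.Unique.DecPropositional.Properties ℕ._≟_ using (deduplicate-!)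
open import Data.Vec as Vec using (Vec; []; _∷_)
open import Data.Vec.Relation.Binary.Pointwise.Inductive using (Pointwise; []; _∷_)
open import Data.Vec.Relation.Unary.All as VecAll using ([]; _∷_)
open import Data.Product using (_×_; _,_; proj₁; proj₂; ∃-syntax; Σ-syntax)
open import Data.Sum using (inj₁; inj₂)
open import Function.Bundles using (mk⇔)
open import Relation.Nullary using (¬_; Dec; contradiction)
open import Relation.Binary.PropositionalEquality
open import Relation.Binary.Bundles using (Setoid)
import Relation.Binary.Reasoning.Setoid as SetoidReasoning
open import Level using (0ℓ)

private
  variable
    x y a : ℤ
    d K L M N : ℕ

module _ {A B : Set} where

  Unique-map⁺-injectiveOn : ∀ (f : A → B) {xs : List A} →
                            (∀ {x y} → x ∈ xs → y ∈ xs → f x ≡ f y → x ≡ y) →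
                            Unique xs → Unique (map f xs)
  Unique-map⁺-injectiveOn f {[]}     _   []                = []
  Unique-map⁺-injectiveOn f {x ∷ xs} inj (x∉xs ∷ unique) =
    AllP.map⁺ (All.tabulate (λ y∈ fx≡fy → All.lookup x∉xs y∈ (inj (here refl) (there y∈) fx≡fy)))
    ∷ Unique-map⁺-injectiveOn f (λ x∈ y∈ → inj (there x∈) (there y∈)) unique

  length-cartesianProduct : ∀ (xs : List A) (ys : List B) →
                            length (cartesianProduct xs ys) ≡ length xs ℕ.* length ys
  length-cartesianProduct []       ys = refl
  length-cartesianProduct (x ∷ xs) ys = begin
    length (map (x ,_) ys List.++ cartesianProduct xs ys)       ≡⟨ ListP.length-++ (map (x ,_) ys) ⟩
    length (map (x ,_) ys) ℕ.+ length (cartesianProduct xs ys)  ≡⟨ cong₂ ℕ._+_ (ListP.length-map (x ,_) ys)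
                                                                          (length-cartesianProduct xs ys) ⟩
    length ys ℕ.+ length xs ℕ.* length ys                       ∎
    where open ≡-Reasoning

  length-≡-bijectiveOn : ∀ (f : A → B) {xs : List A} {ys : List B} → Unique xs → Unique ys →
                         (∀ {x y} → x ∈ xs → y ∈ xs → f x ≡ f y → x ≡ y) →
                         (∀ {x} → x ∈ xs → f x ∈ ys) →
                         (∀ {y} → y ∈ ys → ∃[ x ] x ∈ xs × f x ≡ y) →
                         length xs ≡ length ys
  length-≡-bijectiveOn f {xs} {ys} unique-xs unique-ys inj maps-to onto =
    trans (sym (ListP.length-map f xs)) (↭-length (∼bag⇒↭ (unique∧set⇒bag
      (Unique-map⁺-injectiveOn f inj unique-xs) unique-ys (mk⇔ to from))))
    where
    to : ∀ {y} → y ∈ map f xs → y ∈ ys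
    to y∈ with x , x∈ , refl ← ∈-map⁻ f y∈ = maps-to x∈
    from : ∀ {y} → y ∈ ys → y ∈ map f xs
    from y∈ with x , x∈ , refl ← onto y∈ = ∈-map⁺ f x∈

>1⇒nonZero : ∀ {n} → 1 < n → NonZero n
>1⇒nonZero 1<n = ℕ.>-nonZero (ℕP.<-trans ℕ.z<s 1<n)

1<product : ∀ {n ns} → All (1 <_) (n ∷ ns) → 1 < product (n ∷ ns)
1<product {n} {ns} (1<n ∷ 1<ns) = ℕP.<-≤-trans 1<n (ℕP.m≤m*n n (product ns))
  where
  instance
    product≢0 : NonZero (product ns)
    product≢0 = ListActionP.product≢0 (All.map >1⇒nonZero 1<ns)

coprime-∣⇒*∣ : ∀ {M K N} → Coprime M K → M ℕD.∣ N → K ℕD.∣ N → M ℕ.* K ℕD.∣ N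
coprime-∣⇒*∣ {M} {K} coprime (ℕD.divides q N≡qM) K∣N
  with ℕD.divides r q≡rK ← Coprimality.coprime-divisor (Coprimality.sym coprime)
                             (subst (K ℕD.∣_) (trans N≡qM (ℕP.*-comm q M)) K∣N)
  = ℕD.divides r (begin
      _               ≡⟨ N≡qM ⟩
      q ℕ.* M         ≡⟨ cong (ℕ._* M) q≡rK ⟩
      r ℕ.* K ℕ.* M   ≡⟨ ℕP.*-assoc r K M ⟩
      r ℕ.* (K ℕ.* M) ≡⟨ cong (r ℕ.*_) (ℕP.*-comm K M) ⟩
      r ℕ.* (M ℕ.* K) ∎)
  where open ≡-Reasoning

coprime-∣ʳ : ∀ {m n o} → Coprime m n → o ℕD.∣ n → Coprime m o
coprime-∣ʳ coprime o∣n (i∣m , i∣o) = coprime (i∣m , ℕD.∣-trans i∣o o∣n)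

coprime-1ˡ : ∀ n → Coprime 1 n
coprime-1ˡ n (i∣1 , _) = ℕD.∣1⇒≡1 i∣1

coprime-*ˡ : ∀ {m n o} → Coprime m o → Coprime n o → Coprime (m ℕ.* n) o
coprime-*ˡ {m} {n} {o} m⊥o n⊥o {i} (i∣mn , i∣o) =
  n⊥o (Coprimality.coprime-divisor i⊥m i∣mn , i∣o)
  where
  i⊥m : Coprime i m
  i⊥m (j∣i , j∣m) = m⊥o (j∣m , ℕD.∣-trans j∣i i∣o)

coprime-*ʳ : ∀ {m n o} → Coprime m n → Coprime m o → Coprime m (n ℕ.* o)
coprime-*ʳ m⊥n m⊥o = Coprimality.sym (coprime-*ˡ (Coprimality.sym m⊥n) (Coprimality.sym m⊥o))

coprime-product : ∀ {m ns} → All (Coprime m) ns → Coprime m (product ns)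
coprime-product {m} []              = Coprimality.sym (coprime-1ˡ m)
coprime-product     (m⊥n ∷ m⊥ns) = coprime-*ʳ m⊥n (coprime-product m⊥ns)

coprime-^ˡ : ∀ {m n} i → Coprime m n → Coprime (m ^ i) n
coprime-^ˡ {n = n} zero    _   = coprime-1ˡ n
coprime-^ˡ         (suc i) m⊥n = coprime-*ˡ m⊥n (coprime-^ˡ i m⊥n)

coprime-^ : ∀ {m n} i j → Coprime m n → Coprime (m ^ i) (n ^ j)
coprime-^ i j m⊥n = Coprimality.sym (coprime-^ˡ j (Coprimality.sym (coprime-^ˡ i m⊥n)))

distinct-primes-coprime : ∀ {p q} → Prime p → Prime q → p ≢ q → Coprime p q
distinct-primes-coprime prime-p prime-q p≢q {i} (i∣p , i∣q) with prime⇒irreducible prime-p i∣p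
... | inj₁ i≡1 = i≡1
... | inj₂ refl with prime⇒irreducible prime-q i∣q
...   | inj₁ p≡1 = contradiction p≡1 (ℕ.nonTrivial⇒≢1 {{prime⇒nonTrivial prime-p}})
...   | inj₂ p≡q = contradiction p≡q p≢q

infix 4 _≡_mod_

-- A record rather than the bare divisibility, so that x and y can be recovered by unification.
record _≡_mod_ (x y : ℤ) (N : ℕ) : Set where
  constructor mod-intro
  field divides-difference : + N ℤD.∣ x - y

≡-mod-reflexive : ∀ {x y N} → x ≡ y → x ≡ y mod N
≡-mod-reflexive {x} refl = mod-intro (divides 0ℤ (ℤP.+-inverseʳ x))

≡-mod-refl : x ≡ x mod N
≡-mod-refl = ≡-mod-reflexive refl

≡-mod-sym : ∀ {x y N} → x ≡ y mod N → y ≡ x mod N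
≡-mod-sym {x} {y} (mod-intro N∣x-y) =
  mod-intro (subst (_ ℤD.∣_) (negate-difference x y) (ℤD.∣m⇒∣-m N∣x-y))
  where
  negate-difference : ∀ x y → - (x - y) ≡ y - x
  negate-difference = solve-∀

≡-mod-trans : ∀ {x y z N} → x ≡ y mod N → y ≡ z mod N → x ≡ z mod N
≡-mod-trans {x} {y} {z} (mod-intro N∣x-y) (mod-intro N∣y-z) =
  mod-intro (subst (_ ℤD.∣_) (telescope x y z) (ℤD.∣m∣n⇒∣m+n N∣x-y N∣y-z))
  where
  telescope : ∀ x y z → (x - y) + (y - z) ≡ x - z
  telescope = solve-∀

≡-mod-setoid : ℕ → Setoid 0ℓ 0ℓ
≡-mod-setoid N = record
  { Carrier       = ℤ
  ; _≈_           = λ x y → x ≡ y mod N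
  ; isEquivalence = record { refl = ≡-mod-refl ; sym = ≡-mod-sym ; trans = ≡-mod-trans }
  }

module ≡-mod-Reasoning (N : ℕ) = SetoidReasoning (≡-mod-setoid N)

+-cong-mod : ∀ {x y u v N} → x ≡ y mod N → u ≡ v mod N → x + u ≡ y + v mod N
+-cong-mod {x} {y} {u} {v} (mod-intro N∣x-y) (mod-intro N∣u-v) =
  mod-intro (subst (_ ℤD.∣_) (regroup x y u v) (ℤD.∣m∣n⇒∣m+n N∣x-y N∣u-v))
  where
  regroup : ∀ x y u v → (x - y) + (u - v) ≡ (x + u) - (y + v)
  regroup = solve-∀

-‿cong-mod : ∀ {x y N} → x ≡ y mod N → - x ≡ - y mod N
-‿cong-mod {x} {y} (mod-intro N∣x-y) =
  mod-intro (subst (_ ℤD.∣_) (regroup x y) (ℤD.∣m⇒∣-m N∣x-y))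
  where
  regroup : ∀ x y → - (x - y) ≡ (- x) - (- y)
  regroup = solve-∀

*-cong-mod : ∀ {x y u v N} → x ≡ y mod N → u ≡ v mod N → x * u ≡ y * v mod N
*-cong-mod {x} {y} {u} {v} (mod-intro N∣x-y) (mod-intro N∣u-v) =
  mod-intro (subst (_ ℤD.∣_) (regroup x y u v)
    (ℤD.∣m∣n⇒∣m+n (ℤD.∣n⇒∣m*n x N∣u-v) (ℤD.∣m⇒∣m*n v N∣x-y)))
  where
  regroup : ∀ x y u v → x * (u - v) + (x - y) * v ≡ x * u - y * v
  regroup = solve-∀

+-congˡ-mod : ∀ x {u v N} → u ≡ v mod N → x + u ≡ x + v mod N
+-congˡ-mod x = +-cong-mod (≡-mod-refl {x})

*-congˡ-mod : ∀ x {u v N} → u ≡ v mod N → x * u ≡ x * v mod N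
*-congˡ-mod x = *-cong-mod (≡-mod-refl {x})

≡-mod-∣ : L ℕD.∣ N → x ≡ y mod N → x ≡ y mod L
≡-mod-∣ L∣N (mod-intro N∣x-y) = mod-intro (ℤD.∣-trans (∣ᵤ⇒∣ L∣N) N∣x-y)

≡-mod-combine : Coprime M K → x ≡ y mod M → x ≡ y mod K → x ≡ y mod M ℕ.* K
≡-mod-combine coprime (mod-intro M∣x-y) (mod-intro K∣x-y) =
  mod-intro (∣ᵤ⇒∣ (coprime-∣⇒*∣ coprime (∣⇒∣ᵤ M∣x-y) (∣⇒∣ᵤ K∣x-y)))

≡-mod-+multiple : ∀ y q N → y + q * + N ≡ y mod N
≡-mod-+multiple y q N = mod-intro (divides q (cancel y q (+ N)))
  where
  cancel : ∀ y q n → (y + q * n) - y ≡ q * n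
  cancel = solve-∀

≡-mod-%ℕ : ∀ x N .{{_ : NonZero N}} → x ≡ + (x %ℕ N) mod N
≡-mod-%ℕ x N = subst (_≡ + (x %ℕ N) mod N) (sym (a≡a%ℕn+[a/ℕn]*n x N))
                     (≡-mod-+multiple (+ (x %ℕ N)) (x /ℕ N) N)

∣∧<⇒≡0 : ∀ {n N} → N ℕD.∣ n → n < N → n ≡ 0
∣∧<⇒≡0 {zero}  _   _   = refl
∣∧<⇒≡0 {suc n} N∣n n<N = contradiction (ℕD.∣⇒≤ N∣n) (ℕP.<⇒≱ n<N)

residue-unique : ∀ {r s N} → r < N → s < N → + r ≡ + s mod N → r ≡ s
residue-unique {r} {s} {N} r<N s<N (mod-intro N∣r-s) =
  ℤP.+-injective (ℤP.i-j≡0⇒i≡j (+ r) (+ s) (ℤP.∣i∣≡0⇒i≡0 ∣r-s∣≡0))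
  where
  ∣r-s∣<N : ∣ + r - + s ∣ < N
  ∣r-s∣<N = subst (_< N) (cong ∣_∣ (sym (ℤP.m-n≡m⊖n r s)))
                  (ℕP.≤-<-trans (ℤP.∣m⊝n∣≤m⊔n r s) (ℕP.⊔-lub r<N s<N))
  ∣r-s∣≡0 : ∣ + r - + s ∣ ≡ 0
  ∣r-s∣≡0 = ∣∧<⇒≡0 (∣⇒∣ᵤ N∣r-s) ∣r-s∣<N

≡-mod⇒%ℕ≡ : ∀ {x y} N .{{_ : NonZero N}} → x ≡ y mod N → x %ℕ N ≡ y %ℕ N
≡-mod⇒%ℕ≡ {x} {y} N x≡y = residue-unique (n%ℕd<d x N) (n%ℕd<d y N)
  (≡-mod-trans (≡-mod-sym (≡-mod-%ℕ x N)) (≡-mod-trans x≡y (≡-mod-%ℕ y N)))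

≡-mod⇒%ℕ≡residue : ∀ {x u} N .{{_ : NonZero N}} → u < N → x ≡ + u mod N → x %ℕ N ≡ u
≡-mod⇒%ℕ≡residue N u<N x≡u = trans (≡-mod⇒%ℕ≡ N x≡u) (m<n⇒m%n≡m u<N)

%ℕ≡⇒≡-mod : ∀ {x y} N .{{_ : NonZero N}} → x %ℕ N ≡ y %ℕ N → x ≡ y mod N
%ℕ≡⇒≡-mod {x} {y} N x%N≡y%N = ≡-mod-trans (≡-mod-%ℕ x N)
  (subst (λ r → + r ≡ y mod N) (sym x%N≡y%N) (≡-mod-sym (≡-mod-%ℕ y N)))

infix 4 _≋_mod_

_≋_mod_ : Vec ℕ d → Vec ℕ d → ℕ → Set
xs ≋ ys mod N = Pointwise (λ u v → + u ≡ + v mod N) xs ys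

prodℤ-cong-mod : ∀ {xs ys : Vec ℕ d} → xs ≋ ys mod N → prodℤ xs ≡ prodℤ ys mod N
prodℤ-cong-mod []              = ≡-mod-refl
prodℤ-cong-mod (u≡v ∷ us≋vs) = *-cong-mod u≡v (prodℤ-cong-mod us≋vs)

signedSum-cong-mod : ∀ m {xs ys : Vec ℕ d} → xs ≋ ys mod N →
                     signedSum m xs ≡ signedSum m ys mod N
signedSum-cong-mod m       []              = ≡-mod-refl
signedSum-cong-mod zero    (u≡v ∷ us≋vs) = +-cong-mod (-‿cong-mod u≡v) (signedSum-cong-mod zero us≋vs)
signedSum-cong-mod (suc m) (u≡v ∷ us≋vs) = +-cong-mod u≡v (signedSum-cong-mod m us≋vs)

reduce : (N : ℕ) .{{_ : NonZero N}} → Vec ℕ d → Vec ℕ d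
reduce N = Vec.map (_% N)

≋-reduce : ∀ N .{{_ : NonZero N}} (xs : Vec ℕ d) → xs ≋ reduce N xs mod N
≋-reduce N []       = []
≋-reduce N (x ∷ xs) = ≡-mod-%ℕ (+ x) N ∷ ≋-reduce N xs

InRange : ℕ → ℕ → Set
InRange N v = 1 ≤ v × v < N

InHyperbola : ℤ → ℕ → Vec ℕ d → Set
InHyperbola a N xs = VecAll.All (InRange N) xs × prodℤ xs ≡ a mod N

∈-range⁻ : ∀ {v} → v ∈ List.drop 1 (List.upTo N) → InRange N v
∈-range⁻ {suc k} v∈ with i , i<k , refl ← ∈-applyUpTo⁻ suc v∈ = s≤s z≤n , s≤s i<k

∈-range⁺ : ∀ {v} → InRange N v → v ∈ List.drop 1 (List.upTo N)
∈-range⁺ {suc k} {suc i} (_ , s≤s i<k) = ∈-applyUpTo⁺ suc i<k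

∈-tuples⁻ : ∀ {xs : Vec ℕ d} → xs ∈ tuples N d → VecAll.All (InRange N) xs
∈-tuples⁻ {zero} {xs = []} _ = []
∈-tuples⁻ {suc d} {N} {x ∷ xs} xs∈
  with y , y∈ , x∷xs∈ ← find (∈-concatMap⁻ _ {xs = List.drop 1 (List.upTo N)} xs∈)
  with ys , ys∈ , refl ← ∈-map⁻ (y ∷_) x∷xs∈
  = ∈-range⁻ y∈ ∷ ∈-tuples⁻ ys∈

∈-tuples⁺ : ∀ {xs : Vec ℕ d} → VecAll.All (InRange N) xs → xs ∈ tuples N d
∈-tuples⁺ []                 = here refl
∈-tuples⁺ {N = N} (x∈range ∷ xs∈) =
  ∈-concatMap⁺ _ {xs = List.drop 1 (List.upTo N)} (lose (∈-range⁺ x∈range) (∈-map⁺ (_ ∷_) (∈-tuples⁺ xs∈)))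

coprime⇒≢0-mod : 1 < N → Coprime ∣ a ∣ N → ¬ (a ≡ 0ℤ mod N)
coprime⇒≢0-mod {N} {a} 1<N coprime (mod-intro N∣a-0) =
  ℕP.<⇒≢ 1<N (sym (coprime (N∣a , ℕD.∣-refl)))
  where
  N∣a : N ℕD.∣ ∣ a ∣
  N∣a = subst (λ b → N ℕD.∣ ∣ b ∣) (ℤP.+-identityʳ a) (∣⇒∣ᵤ N∣a-0)

reduce-inRange : ∀ N .{{_ : NonZero N}} (xs : Vec ℕ d) →
                 ¬ (prodℤ xs ≡ 0ℤ mod N) → VecAll.All (InRange N) (reduce N xs)
reduce-inRange N []       _       = []
reduce-inRange N (x ∷ xs) prod≢0 =
  (ℕP.n≢0⇒n>0 x%N≢0 , m%n<n x N) ∷ reduce-inRange N xs (λ p → prod≢0 (absorbed p))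
  where
  absorbed : prodℤ xs ≡ 0ℤ mod N → + x * prodℤ xs ≡ 0ℤ mod N
  absorbed p = ≡-mod-trans (*-congˡ-mod (+ x) p) (≡-mod-reflexive (ℤP.*-zeroʳ (+ x)))
  x%N≢0 : x % N ≢ 0
  x%N≢0 x%N≡0 = prod≢0 (≡-mod-trans (*-cong-mod x≡0 ≡-mod-refl)
                                     (≡-mod-reflexive (ℤP.*-zeroˡ (prodℤ xs))))
    where
    x≡0 : + x ≡ 0ℤ mod N
    x≡0 = subst (λ r → + x ≡ + r mod N) x%N≡0 (≡-mod-%ℕ (+ x) N)

reduce-inHyperbola : ∀ N .{{_ : NonZero N}} {xs : Vec ℕ d} → 1 < N → Coprime ∣ a ∣ N →
                     prodℤ xs ≡ a mod N → InHyperbola a N (reduce N xs)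
reduce-inHyperbola N {xs} 1<N coprime prod≡a =
  reduce-inRange N xs (λ prod≡0 → coprime⇒≢0-mod 1<N coprime (≡-mod-trans (≡-mod-sym prod≡a) prod≡0)) ,
  ≡-mod-trans (≡-mod-sym (prodℤ-cong-mod (≋-reduce N xs))) prod≡a

+[r+q*N]≡r-mod : ∀ r q N → + (r ℕ.+ q ℕ.* N) ≡ + r mod N
+[r+q*N]≡r-mod r q N = subst (_≡ + r mod N) (sym +[r+q*N]≡+r++q*+N) (≡-mod-+multiple (+ r) (+ q) N)
  where
  +[r+q*N]≡+r++q*+N : + (r ℕ.+ q ℕ.* N) ≡ + r + + q * + N
  +[r+q*N]≡+r++q*+N = trans (ℤP.pos-+ r (q ℕ.* N)) (cong (λ t → + r + t) (ℤP.pos-* q N))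

crt-via-idempotent : ∀ {e M K} → e ≡ 0ℤ mod M → e ≡ 1ℤ mod K → ∀ u v →
                     u + (v - u) * e ≡ u mod M × u + (v - u) * e ≡ v mod K
crt-via-idempotent {e} {M} {K} e≡0 e≡1 u v =
  (let open ≡-mod-Reasoning M in begin
    u + (v - u) * e   ≈⟨ +-congˡ-mod u (*-congˡ-mod (v - u) e≡0) ⟩
    u + (v - u) * 0ℤ  ≡⟨ at-0 u v ⟩
    u                 ∎) ,
  (let open ≡-mod-Reasoning K in begin
    u + (v - u) * e   ≈⟨ +-congˡ-mod u (*-congˡ-mod (v - u) e≡1) ⟩
    u + (v - u) * 1ℤ  ≡⟨ at-1 u v ⟩
    v                 ∎)
  where
  at-0 : ∀ u v → u + (v - u) * 0ℤ ≡ u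
  at-0 = solve-∀
  at-1 : ∀ u v → u + (v - u) * 1ℤ ≡ v
  at-1 = solve-∀

chineseRemainder : Coprime M K → ∀ u v → ∃[ w ] (w ≡ u mod M × w ≡ v mod K)
chineseRemainder {M} {K} coprime u v with Coprimality.coprime-Bézout coprime
... | Bézout.+- s t 1+tK≡sM =
  _ , crt-via-idempotent (+[r+q*N]≡r-mod 0 s M)
                         (subst (λ n → + n ≡ 1ℤ mod K) 1+tK≡sM (+[r+q*N]≡r-mod 1 t K)) u v
... | Bézout.-+ s t 1+sM≡tK =
  let v≡ , u≡ = crt-via-idempotent (+[r+q*N]≡r-mod 0 t K)
                  (subst (λ n → + n ≡ 1ℤ mod M) 1+sM≡tK (+[r+q*N]≡r-mod 1 s M)) v u
  in _ , u≡ , v≡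

chineseRemainder-Vec : .{{_ : NonZero M}} .{{_ : NonZero K}} → Coprime M K → (ys zs : Vec ℕ d) →
                       ∃[ ws ] (ws ≋ ys mod M × ws ≋ zs mod K)
chineseRemainder-Vec coprime []       []       = [] , [] , []
chineseRemainder-Vec {M} {K} coprime (y ∷ ys) (z ∷ zs)
  with w , w≡y , w≡z ← chineseRemainder coprime (+ y) (+ z)
  with ws , ws≋ys , ws≋zs ← chineseRemainder-Vec coprime ys zs
  = w %ℕ (M ℕ.* K) ∷ ws , via (ℕD.m∣m*n K) w≡y ∷ ws≋ys , via (ℕD.n∣m*n M) w≡z ∷ ws≋zs
  where
  instance
    MK≢0 : NonZero (M ℕ.* K)
    MK≢0 = ℕP.m*n≢0 M K
  via : ∀ {L t} → L ℕD.∣ M ℕ.* K → w ≡ t mod L → + (w %ℕ (M ℕ.* K)) ≡ t mod L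
  via L∣MK w≡t = ≡-mod-trans (≡-mod-∣ L∣MK (≡-mod-sym (≡-mod-%ℕ w (M ℕ.* K)))) w≡t

module _ (d m : ℕ) (a : ℤ) where

  private
    sumResidue : ∀ N .{{_ : NonZero N}} → Vec ℕ d → ℕ
    sumResidue N xs = signedSum m xs %ℕ N

    onHyperbola? : ∀ N .{{_ : NonZero N}} (xs : Vec ℕ d) → Dec (prodℤ xs %ℕ N ≡ a %ℕ N)
    onHyperbola? N xs = prodℤ xs %ℕ N ℕ.≟ a %ℕ N

  signedSumset-unique : ∀ N → Unique (signedSumset d m a N)
  signedSumset-unique zero    = []
  signedSumset-unique (suc _) = deduplicate-! _

  ∈-signedSumset⁻ : ∀ N .{{_ : NonZero N}} {r} → r ∈ signedSumset d m a N →
                    Σ[ xs ∈ Vec ℕ d ] InHyperbola a N xs × r ≡ signedSum m xs %ℕ N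
  ∈-signedSumset⁻ N@(suc _) r∈
    with xs , xs∈ , r≡ , prod≡ ←
           ∈-map∘filter⁻ (sumResidue N) (onHyperbola? N) {xs = tuples N d}
             (∈-deduplicate⁻ ℕ._≟_ (map (sumResidue N) (filter (onHyperbola? N) (tuples N d))) r∈)
    = xs , (∈-tuples⁻ xs∈ , %ℕ≡⇒≡-mod N prod≡) , r≡

  ∈-signedSumset⁺ : ∀ N .{{_ : NonZero N}} {xs : Vec ℕ d} → InHyperbola a N xs →
                    signedSum m xs %ℕ N ∈ signedSumset d m a N
  ∈-signedSumset⁺ N@(suc _) {xs} (inRange , prod≡a) =
    ∈-deduplicate⁺ ℕ._≟_ (∈-map∘filter⁺ (sumResidue N) (onHyperbola? N) {xs = tuples N d}
      (xs , ∈-tuples⁺ inRange , refl , ≡-mod⇒%ℕ≡ N prod≡a))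

  ∈-signedSumset⇒< : ∀ N .{{_ : NonZero N}} {r} → r ∈ signedSumset d m a N → r < N
  ∈-signedSumset⇒< N r∈ with xs , _ , r≡ ← ∈-signedSumset⁻ N r∈ =
    subst (_< N) (sym r≡) (n%ℕd<d (signedSum m xs) N)

  %ℕ-∈-signedSumset : ∀ N L .{{_ : NonZero N}} .{{_ : NonZero L}} {r} →
                      L ℕD.∣ N → 1 < L → Coprime ∣ a ∣ L →
                      r ∈ signedSumset d m a N → + r %ℕ L ∈ signedSumset d m a L
  %ℕ-∈-signedSumset N L {r} L∣N 1<L coprime r∈
    with xs , (_ , prod≡a) , r≡ ← ∈-signedSumset⁻ N r∈
    = subst (_∈ signedSumset d m a L) (sym (≡-mod⇒%ℕ≡ L r≡reduced))
        (∈-signedSumset⁺ L (reduce-inHyperbola L {xs} 1<L coprime (≡-mod-∣ L∣N prod≡a)))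
    where
    open ≡-mod-Reasoning L
    r≡reduced : + r ≡ signedSum m (reduce L xs) mod L
    r≡reduced = begin
      + r                         ≡⟨ cong +_ r≡ ⟩
      + (signedSum m xs %ℕ N)     ≈⟨ ≡-mod-∣ L∣N (≡-mod-sym (≡-mod-%ℕ (signedSum m xs) N)) ⟩
      signedSum m xs              ≈⟨ signedSum-cong-mod m (≋-reduce L xs) ⟩
      signedSum m (reduce L xs)   ∎

  crt-∈-signedSumset : ∀ M K .{{_ : NonZero M}} .{{_ : NonZero K}} {u v} →
                       Coprime M K → 1 < M ℕ.* K → Coprime ∣ a ∣ (M ℕ.* K) →
                       u ∈ signedSumset d m a M → v ∈ signedSumset d m a K →
                       ∃[ r ] r ∈ signedSumset d m a (M ℕ.* K) × + r ≡ + u mod M × + r ≡ + v mod K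
  crt-∈-signedSumset M K coprimeMK 1<n coprime u∈ v∈
    with ys , (_ , prodys≡a) , u≡ ← ∈-signedSumset⁻ M u∈
    with zs , (_ , prodzs≡a) , v≡ ← ∈-signedSumset⁻ K v∈
    with ws , ws≋ys , ws≋zs ← chineseRemainder-Vec coprimeMK ys zs
    = signedSum m reduced %ℕ n ,
      ∈-signedSumset⁺ n (reduce-inHyperbola n {ws} 1<n coprime prodws≡a) ,
      lifts (ℕD.m∣m*n K) ws≋ys u≡ ,
      lifts (ℕD.n∣m*n M) ws≋zs v≡
    where
    n = M ℕ.* K
    instance
      n≢0 : NonZero n
      n≢0 = ℕP.m*n≢0 M K
    reduced = reduce n ws
    prodws≡a : prodℤ ws ≡ a mod n
    prodws≡a = ≡-mod-combine coprimeMK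
      (≡-mod-trans (prodℤ-cong-mod ws≋ys) prodys≡a)
      (≡-mod-trans (prodℤ-cong-mod ws≋zs) prodzs≡a)
    lifts : ∀ {L t} {ts : Vec ℕ d} .{{_ : NonZero L}} → L ℕD.∣ n → ws ≋ ts mod L →
            t ≡ signedSum m ts %ℕ L → + (signedSum m reduced %ℕ n) ≡ + t mod L
    lifts {L} {t} {ts} L∣n ws≋ts t≡ = begin
      + (signedSum m reduced %ℕ n)  ≈⟨ ≡-mod-∣ L∣n (≡-mod-sym (≡-mod-%ℕ (signedSum m reduced) n)) ⟩
      signedSum m reduced           ≈⟨ ≡-mod-∣ L∣n (≡-mod-sym (signedSum-cong-mod m (≋-reduce n ws))) ⟩
      signedSum m ws                ≈⟨ signedSum-cong-mod m ws≋ts ⟩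
      signedSum m ts                ≈⟨ ≡-mod-%ℕ (signedSum m ts) L ⟩
      + (signedSum m ts %ℕ L)       ≡⟨ cong +_ (sym t≡) ⟩
      + t                           ∎
      where open ≡-mod-Reasoning L

  #S̄-multiplicative : ∀ M K → 1 < M → 1 < K → Coprime M K → Coprime ∣ a ∣ (M ℕ.* K) →
                      #S̄ d m a (M ℕ.* K) ≡ #S̄ d m a M ℕ.* #S̄ d m a K
  #S̄-multiplicative M K 1<M 1<K coprimeMK coprime =
    trans (length-≡-bijectiveOn residues (signedSumset-unique n)
            (UniqueP.cartesianProduct⁺ (signedSumset-unique M) (signedSumset-unique K))
            residues-injective residues-∈ residues-onto)
          (length-cartesianProduct (signedSumset d m a M) (signedSumset d m a K))
    where
    n = M ℕ.* K
    instance
      M≢0 : NonZero M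
      M≢0 = >1⇒nonZero 1<M
      K≢0 : NonZero K
      K≢0 = >1⇒nonZero 1<K
      n≢0 : NonZero n
      n≢0 = ℕP.m*n≢0 M K
    1<n : 1 < n
    1<n = ℕP.<-≤-trans 1<M (ℕP.m≤m*n M K)
    residues : ℕ → ℕ × ℕ
    residues r = + r %ℕ M , + r %ℕ K
    residues-∈ : ∀ {r} → r ∈ signedSumset d m a n →
                 residues r ∈ cartesianProduct (signedSumset d m a M) (signedSumset d m a K)
    residues-∈ r∈ = ∈-cartesianProduct⁺
      (%ℕ-∈-signedSumset n M (ℕD.m∣m*n K) 1<M (coprime-∣ʳ coprime (ℕD.m∣m*n K)) r∈)
      (%ℕ-∈-signedSumset n K (ℕD.n∣m*n M) 1<K (coprime-∣ʳ coprime (ℕD.n∣m*n M)) r∈)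
    residues-injective : ∀ {r s} → r ∈ signedSumset d m a n → s ∈ signedSumset d m a n →
                         residues r ≡ residues s → r ≡ s
    residues-injective r∈ s∈ r≡s = residue-unique (∈-signedSumset⇒< n r∈) (∈-signedSumset⇒< n s∈)
      (≡-mod-combine coprimeMK (%ℕ≡⇒≡-mod M (cong proj₁ r≡s)) (%ℕ≡⇒≡-mod K (cong proj₂ r≡s)))
    residues-onto : ∀ {uv} → uv ∈ cartesianProduct (signedSumset d m a M) (signedSumset d m a K) →
                    ∃[ r ] r ∈ signedSumset d m a n × residues r ≡ uv
    residues-onto {u , v} uv∈ =
      let u∈ , v∈             = ∈-cartesianProduct⁻ (signedSumset d m a M) (signedSumset d m a K) uv∈
          r , r∈ , r≡u , r≡v = crt-∈-signedSumset M K coprimeMK 1<n coprime u∈ v∈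
      in r , r∈ , cong₂ _,_ (≡-mod⇒%ℕ≡residue M (∈-signedSumset⇒< M u∈) r≡u)
                            (≡-mod⇒%ℕ≡residue K (∈-signedSumset⇒< K v∈) r≡v)

  #S̄-product : ∀ n ns → All (1 <_) (n ∷ ns) → AllPairs Coprime (n ∷ ns) →
               Coprime ∣ a ∣ (product (n ∷ ns)) →
               #S̄ d m a (product (n ∷ ns)) ≡ product (map (#S̄ d m a) (n ∷ ns))
  #S̄-product n []        _                 _                     _       =
    trans (cong (#S̄ d m a) (ℕP.*-identityʳ n)) (sym (ℕP.*-identityʳ (#S̄ d m a n)))
  #S̄-product n (n′ ∷ ns) (1<n ∷ 1<n′∷ns) (n⊥n′∷ns ∷ pairwise) coprime = begin
    #S̄ d m a (n ℕ.* product (n′ ∷ ns))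
      ≡⟨ #S̄-multiplicative n _ 1<n (1<product 1<n′∷ns) (coprime-product n⊥n′∷ns) coprime ⟩
    #S̄ d m a n ℕ.* #S̄ d m a (product (n′ ∷ ns))
      ≡⟨ cong (#S̄ d m a n ℕ.*_) (#S̄-product n′ ns 1<n′∷ns pairwise (coprime-∣ʳ coprime (ℕD.n∣m*n n))) ⟩
    #S̄ d m a n ℕ.* product (map (#S̄ d m a) (n′ ∷ ns)) ∎
    where open ≡-Reasoning

primePower : ℕ × ℕ → ℕ
primePower pe = proj₁ pe ^ proj₂ pe

1<primePower : ∀ {p e} → Prime p → 1 ≤ e → 1 < p ^ e
1<primePower {p} prime-p 1≤e =
  ℕP.^-monoʳ-< p (ℕ.nonTrivial⇒n>1 p {{prime⇒nonTrivial prime-p}}) 1≤e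

primePowers-pairwiseCoprime : ∀ {fac : List (ℕ × ℕ)} → All (λ pe → Prime (proj₁ pe)) fac →
                              Unique (map proj₁ fac) → AllPairs Coprime (map primePower fac)
primePowers-pairwiseCoprime []                     []                 = []
primePowers-pairwiseCoprime {(p , e) ∷ fac} (prime-p ∷ primes) (p∉fac ∷ distinct) =
  AllP.map⁺ {f = primePower}
    (All.zipWith (λ {qf} → coprime-powers {qf}) (primes , AllP.map⁻ p∉fac))
  ∷ primePowers-pairwiseCoprime primes distinct
  where
  coprime-powers : ∀ {qf} → Prime (proj₁ qf) × p ≢ proj₁ qf → Coprime (p ^ e) (primePower qf)
  coprime-powers {qf} (prime-q , p≢q) =
    coprime-^ e (proj₂ qf) (distinct-primes-coprime prime-p prime-q p≢q)

proposition2p1 : (d m n : ℕ) (a : ℤ) (fac : List (ℕ × ℕ)) →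
    1 ≤ d → m ≤ d → 2 ≤ n →
    All (λ pe → Prime (proj₁ pe) × 1 ≤ proj₂ pe) fac →
    Unique (map proj₁ fac) →
    product (map (λ pe → proj₁ pe ^ proj₂ pe) fac) ≡ n →
    gcd a (+ n) ≡ + 1 →
    #S̄ d m a n ≡ product (map (λ pe → #S̄ d m a (proj₁ pe ^ proj₂ pe)) fac)
proposition2p1 d m n a []       _ _ (s≤s (s≤s _)) _ _ () _
proposition2p1 d m n a (pe ∷ fac) _ _ _ conditions distinct refl gcd≡1 = begin
  #S̄ d m a (product (map primePower (pe ∷ fac)))
    ≡⟨ #S̄-product d m a (primePower pe) (map primePower fac)
         (AllP.map⁺ {f = primePower} (All.map (λ (prime-p , 1≤e) → 1<primePower prime-p 1≤e) conditions))
         (primePowers-pairwiseCoprime (All.map proj₁ conditions) distinct)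
         (Coprimality.gcd≡1⇒coprime (ℤP.+-injective gcd≡1)) ⟩
  product (map (#S̄ d m a) (map primePower (pe ∷ fac)))
    ≡⟨ cong product (sym (ListP.map-∘ {g = #S̄ d m a} {f = primePower} (pe ∷ fac))) ⟩
  product (map (λ pe → #S̄ d m a (primePower pe)) (pe ∷ fac)) ∎
  where open ≡-Reasoning
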